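{- For $n\ge 1$ let $a_n = |S_n^2(231,312,321)|$. Then $a_1=1$, $a_2=4$, and $a_{n+1} = a_n + 3a_{n-1}$ for all $n\ge 2$.
   Context: A $3$-permutation of size $n$ is an ordered pair $(\sigma,\sigma')$ of permutations of $[n]=\{1,\dots,n\}$. A (classical) permutation $\tau\in S_n$ contains a pattern $\pi\in S_k$ if there are indices $c_1<\dots<c_k$ such that $\tau(c_1)\cdots\tau(c_k)$ is order-isomorphic to $\pi$, and avoids $\pi$ otherwise. A $3$-permutation $(\sigma,\sigma')$ avoids a pattern $\pi\in S_k$ if each of the three permutations $\sigma$, $\sigma'$, and $\sigma'\circ\sigma^{ -1}$ (where $(\sigma'\circ\sigma^{ -1})(i)=\sigma'(\sigma^{ -1}(i))$) avoids $\pi$. $S_n^2(\pi_1,\dots,\pi_m)$ denotes the set of $3$-permutations of size $n$ avoiding each of $\pi_1,\dots,\pi_m$. Patterns are written in one-line notation. -}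

module Defs where

open import Data.Nat using (ℕ; zero; suc; _+_; _*_; _<_)
open import Data.Fin using (Fin; toℕ)
import Data.Fin as F
open import Data.Vec using (Vec; lookup; []; _∷_)
open import Data.List using (List; []; _∷_)
open import Data.List.Relation.Unary.All using (All)
open import Data.Product using (Σ; _×_; _,_)
open import Relation.Binary.PropositionalEquality using (_≡_)
open import Relation.Nullary using (¬_)
open import Function.Bundles using (_⇔_)

-- Proof fields are irrelevant, so a permutation is
-- determined by its one-line notation (needed for counting).
record Perm (n : ℕ) : Set where
  constructor mkPerm
  field
    to   : Vec (Fin n) n
    from : Vec (Fin n) n
    .to∘from : ∀ i → lookup to (lookup from i) ≡ i
    .from∘to : ∀ i → lookup from (lookup to i) ≡ i

open Perm public

app : ∀ {n} → Perm n → Fin n → Fin n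
app σ i = lookup (to σ) i

appInv : ∀ {n} → Perm n → Fin n → Fin n
appInv σ i = lookup (from σ) i

-- A pattern of length k in one-line notation (entries are natural numbers;
-- only their relative order matters, e.g. 231 is 2 ∷ 3 ∷ 1 ∷ []).
Pattern : Set
Pattern = Σ ℕ (Vec ℕ)

Contains : ∀ {n} → (Fin n → Fin n) → Pattern → Set
Contains {n} τ (k , p) =
  Σ (Fin k → Fin n) λ c →
    (∀ a b → a F.< b → c a F.< c b) ×
    (∀ a b → (toℕ (τ (c a)) < toℕ (τ (c b))) ⇔ (lookup p a < lookup p b))

Avoids : ∀ {n} → (Fin n → Fin n) → Pattern → Set
Avoids τ p = ¬ Contains τ p

comp-inv : ∀ {n} → Perm n → Perm n → Fin n → Fin n
comp-inv σ σ' i = app σ' (appInv σ i)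

Avoids3 : ∀ {n} → Perm n → Perm n → Pattern → Set
Avoids3 σ σ' p = Avoids (app σ) p × Avoids (app σ') p × Avoids (comp-inv σ σ') p

-- S_n^2(π₁,…,π_m) as a type; avoidance proof is irrelevant so elements
-- are determined by the pair (σ, σ').
record S2 (n : ℕ) (ps : List Pattern) : Set where
  constructor mk3
  field
    σ  : Perm n
    σ' : Perm n
    .avoidsAll : All (Avoids3 σ σ') ps

p231 p312 p321 : Pattern
p231 = 3 , (2 ∷ 3 ∷ 1 ∷ [])
p312 = 3 , (3 ∷ 1 ∷ 2 ∷ [])
p321 = 3 , (3 ∷ 2 ∷ 1 ∷ [])

-- The sequence a₁ = 1, a₂ = 4, a_{n+1} = a_n + 3 a_{n-1} (n ≥ 2);
-- a₀ = 0 is an unused dummy value.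
a : ℕ → ℕ
a zero = 0
a (suc zero) = 1
a (suc (suc zero)) = 4
a (suc (suc (suc n))) = a (suc (suc n)) + 3 * a (suc n)

{-# OPTIONS --safe #-}
-- A permutation avoids 231, 312 and 321 iff all its inversions are between
-- adjacent positions: a value strictly between the two positions of a longer inversion
-- completes one of the three patterns. Such permutations are the direct sums of blocks
-- 1 and 21, i.e. compositions of n into parts 1 and 2. Scanning (σ, σ′) from the left,
-- σ′σ⁻¹ is of the same kind iff the blocks of σ and σ′ never overlap properly: at each
-- step both fix the next point, or the next two points form a block 21 of σ only, of σ′
-- only, or of both. So S²ₙ is in bijection with tilings of [n] by monominoes and
-- dominoes in three colours, whose number satisfies a(n+1) = a(n) + 3 a(n-1).
module Submission where

open import Defs
open import Data.Nat using (ℕ; _≤_)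
open import Data.Fin using (Fin)
open import Data.List using (List; []; _∷_)
open import Function.Bundles using (_↔_)

open import Data.Nat using (zero; suc; _+_; _*_; _∸_; _<_; z≤n; s≤s; z<s; s<s; s<s⁻¹; _≟_; _<?_)
open import Data.Nat.Properties
open import Data.Fin as Fin using (toℕ; fromℕ<)
open import Data.Fin.Properties using (toℕ-injective; toℕ<n; toℕ-fromℕ<; fromℕ<-toℕ; +↔⊎; *↔×)
import Data.Fin.Properties as Finₚ
open import Data.Vec using (Vec; lookup; tabulate; []; _∷_)
open import Data.Vec.Properties using (lookup∘tabulate; tabulate∘lookup; tabulate-cong)
open import Data.List.Relation.Unary.All as All using ([]; _∷_)
open import Data.Empty using (⊥-elim-irr)
open import Data.Sum using (_⊎_; inj₁; inj₂; [_,_])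
open import Data.Sum.Function.Propositional using (_⊎-↔_)
open import Data.Product using (_×_; _,_; proj₁; proj₂; map)
open import Data.Product.Function.NonDependent.Propositional using (_×-↔_)
open import Function using (_∘_)
open import Function.Bundles using (_⇔_; mk↔ₛ′; mk⇔; Equivalence)
open import Function.Definitions using (Injective)
open import Function.Properties.Inverse using (↔-trans; ↔-sym; ↔-refl)
open import Relation.Binary using (tri<; tri≈; tri>)
open import Relation.Binary.Core using (_Preserves_⟶_)
open import Relation.Binary.PropositionalEquality
  using (_≡_; _≢_; _≗_; refl; sym; trans; cong; cong₂; subst; subst₂; ≢-sym; module ≡-Reasoning)
open import Relation.Nullary using (Dec; yes; no; contradiction)
open import Relation.Nullary.Decidable using (recompute)

open ≡-Reasoning

-- Layered permutations of ℕ

Adjacent : (ℕ → ℕ) → Set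
Adjacent h = ∀ {i j} → i < j → h j < h i → j ≡ suc i

FixedFrom : ℕ → (ℕ → ℕ) → Set
FixedFrom k h = ∀ {i} → k ≤ i → h i ≡ i

PrefixClosed : ℕ → (ℕ → ℕ) → Set
PrefixClosed m f = ∀ {i} → i < m → f i < m

adjacent-cong : ∀ {h h′} → h ≗ h′ → Adjacent h → Adjacent h′
adjacent-cong h≗h′ adj i<j lt = adj i<j (subst₂ _<_ (sym (h≗h′ _)) (sym (h≗h′ _)) lt)

adjacent-shift : ∀ m {h h′} → (∀ i → h (m + i) ≡ m + h′ i) → Adjacent h → Adjacent h′
adjacent-shift m {h} spec adj {i} {j} i<j lt =
  +-cancelˡ-≡ m j (suc i) (trans (adj (+-monoʳ-< m i<j) shifted) (sym (+-suc m i)))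
  where
  shifted : h (m + j) < h (m + i)
  shifted = subst₂ _<_ (sym (spec j)) (sym (spec i)) (+-monoʳ-< m lt)

-- A composition of k into parts 1 and 2; ⟦ u ⟧ is the corresponding direct sum
-- of blocks 1 and 21, extended by the identity beyond k.
data Layers : ℕ → Set where
  none : Layers 0
  fix  : ∀ {k} → Layers k → Layers (suc k)
  swap : ∀ {k} → Layers k → Layers (suc (suc k))

⟦_⟧ : ∀ {k} → Layers k → ℕ → ℕ
⟦ none ⟧ i = i
⟦ fix u ⟧ zero = zero
⟦ fix u ⟧ (suc i) = suc (⟦ u ⟧ i)
⟦ swap u ⟧ zero = 1
⟦ swap u ⟧ (suc zero) = 0
⟦ swap u ⟧ (suc (suc i)) = 2 + ⟦ u ⟧ i

⟦⟧-involutive : ∀ {k} (u : Layers k) i → ⟦ u ⟧ (⟦ u ⟧ i) ≡ i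
⟦⟧-involutive none i = refl
⟦⟧-involutive (fix u) zero = refl
⟦⟧-involutive (fix u) (suc i) = cong suc (⟦⟧-involutive u i)
⟦⟧-involutive (swap u) zero = refl
⟦⟧-involutive (swap u) (suc zero) = refl
⟦⟧-involutive (swap u) (suc (suc i)) = cong (2 +_) (⟦⟧-involutive u i)

⟦⟧-bounded : ∀ {k} (u : Layers k) → PrefixClosed k ⟦ u ⟧
⟦⟧-bounded (fix u) {zero} _ = z<s
⟦⟧-bounded (fix u) {suc i} (s<s i<k) = s<s (⟦⟧-bounded u i<k)
⟦⟧-bounded (swap u) {zero} _ = s<s z<s
⟦⟧-bounded (swap u) {suc zero} _ = z<s
⟦⟧-bounded (swap u) {suc (suc i)} (s<s (s<s i<k)) = s<s (s<s (⟦⟧-bounded u i<k))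

⟦⟧-fixedFrom : ∀ {k} (u : Layers k) → FixedFrom k ⟦ u ⟧
⟦⟧-fixedFrom none _ = refl
⟦⟧-fixedFrom (fix u) (s≤s k≤i) = cong suc (⟦⟧-fixedFrom u k≤i)
⟦⟧-fixedFrom (swap u) (s≤s (s≤s k≤i)) = cong (2 +_) (⟦⟧-fixedFrom u k≤i)

⟦⟧-adjacent : ∀ {k} (u : Layers k) → Adjacent ⟦ u ⟧
⟦⟧-adjacent none i<j j<i = contradiction j<i (<-asym i<j)
⟦⟧-adjacent (fix u) {zero} {suc j} _ ()
⟦⟧-adjacent (fix u) {suc i} {suc j} (s<s i<j) (s<s lt) = cong suc (⟦⟧-adjacent u i<j lt)
⟦⟧-adjacent (swap u) {zero} {suc zero} _ _ = refl
⟦⟧-adjacent (swap u) {zero} {suc (suc j)} _ (s<s ())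
⟦⟧-adjacent (swap u) {suc zero} _ ()
⟦⟧-adjacent (swap u) {suc (suc i)} {suc (suc j)} (s<s (s<s i<j)) (s<s (s<s lt)) =
  cong (2 +_) (⟦⟧-adjacent u i<j lt)

⟦⟧-injective : ∀ {k} (u v : Layers k) → ⟦ u ⟧ ≗ ⟦ v ⟧ → u ≡ v
⟦⟧-injective none none _ = refl
⟦⟧-injective (fix u) (fix v) eq = cong fix (⟦⟧-injective u v (suc-injective ∘ eq ∘ suc))
⟦⟧-injective (swap u) (swap v) eq =
  cong swap (⟦⟧-injective u v (suc-injective ∘ suc-injective ∘ eq ∘ (2 +_)))
⟦⟧-injective (fix u) (swap v) eq = contradiction (eq 0) 0≢1+n
⟦⟧-injective (swap u) (fix v) eq = contradiction (eq 0) 1+n≢0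

record IsLayered (h : ℕ → ℕ) : Set where
  field
    inv           : ℕ → ℕ
    left-inverse  : ∀ i → inv (h i) ≡ i
    right-inverse : ∀ i → h (inv i) ≡ i
    adjacent      : Adjacent h

module FirstLayer {h : ℕ → ℕ} (L : IsLayered h) where
  open IsLayered L

  -- a value below h 0 sits to the right of position 0, so adjacency puts it at position 1
  preimage-below-head : ∀ {v} → v < h 0 → inv v ≡ 1
  preimage-below-head {v} v<h0 =
    adjacent (n≢0⇒n>0 inv-v≢0) (subst (_< h 0) (sym (right-inverse v)) v<h0)
    where
    inv-v≢0 : inv v ≢ 0
    inv-v≢0 inv-v≡0 = <-irrefl (trans (sym (right-inverse v)) (cong h inv-v≡0)) v<h0

  head≤1 : h 0 ≤ 1
  head≤1 = ≮⇒≥ λ 1<h0 → 0≢1+n (begin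
    0          ≡⟨ sym (right-inverse 0) ⟩
    h (inv 0)  ≡⟨ cong h (trans (preimage-below-head (<-trans z<s 1<h0))
                                (sym (preimage-below-head 1<h0))) ⟩
    h (inv 1)  ≡⟨ right-inverse 1 ⟩
    1          ∎)

  head-swap : h 0 ≡ 1 → h 1 ≡ 0
  head-swap h0≡1 =
    trans (cong h (sym (preimage-below-head (subst (0 <_) (sym h0≡1) z<s)))) (right-inverse 0)

  head-fix : h 0 ≢ 1 → h 0 ≡ 0
  head-fix h0≢1 with n≤1⇒n≡0∨n≡1 head≤1
  ... | inj₁ h0≡0 = h0≡0
  ... | inj₂ h0≡1 = contradiction h0≡1 h0≢1

open FirstLayer

shift : ℕ → (ℕ → ℕ) → ℕ → ℕ
shift m h i = h (m + i) ∸ m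

shift-fixedFrom : ∀ m {k h} → FixedFrom (m + k) h → FixedFrom k (shift m h)
shift-fixedFrom m fixed {i} k≤i = trans (cong (_∸ m) (fixed (+-monoʳ-≤ m k≤i))) (m+n∸m≡n m i)

module _ {m : ℕ} {f g : ℕ → ℕ} (g∘f : ∀ i → g (f i) ≡ i) (g-closed : PrefixClosed m g) where

  above-prefix : ∀ i → m ≤ f (m + i)
  above-prefix i = ≮⇒≥ λ f<m → <⇒≱ (subst (_< m) (g∘f (m + i)) (g-closed f<m)) (m≤m+n m i)

  shift-spec : ∀ i → f (m + i) ≡ m + shift m f i
  shift-spec i = sym (m+[n∸m]≡n (above-prefix i))

  shift-inverse : ∀ i → shift m g (shift m f i) ≡ i
  shift-inverse i = begin
    g (m + shift m f i) ∸ m  ≡⟨ cong (λ x → g x ∸ m) (sym (shift-spec i)) ⟩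
    g (f (m + i)) ∸ m        ≡⟨ cong (_∸ m) (g∘f (m + i)) ⟩
    m + i ∸ m                ≡⟨ m+n∸m≡n m i ⟩
    i                        ∎

shift-isLayered : ∀ {m h} (L : IsLayered h) → PrefixClosed m h → PrefixClosed m (IsLayered.inv L) →
                  IsLayered (shift m h)
shift-isLayered {m} L h-closed inv-closed = record
  { inv           = shift m inv
  ; left-inverse  = shift-inverse left-inverse inv-closed
  ; right-inverse = shift-inverse right-inverse h-closed
  ; adjacent      = adjacent-shift m (shift-spec left-inverse inv-closed) adjacent
  }
  where open IsLayered L

module _ {h : ℕ → ℕ} (L : IsLayered h) where
  open IsLayered L

  fix-step : ∀ {k} {u : Layers k} → h 0 ≡ 0 →
             (IsLayered (shift 1 h) → shift 1 h ≗ ⟦ u ⟧) → h ≗ ⟦ fix u ⟧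
  fix-step h0≡0 ih zero = h0≡0
  fix-step h0≡0 ih (suc i) =
    trans (shift-spec left-inverse inv-closed i) (cong suc (ih (shift-isLayered L h-closed inv-closed) i))
    where
    h-closed : PrefixClosed 1 h
    h-closed (s≤s z≤n) = s≤s (≤-reflexive h0≡0)
    inv-closed : PrefixClosed 1 inv
    inv-closed (s≤s z≤n) = s≤s (≤-reflexive (trans (cong inv (sym h0≡0)) (left-inverse 0)))

  swap-step : ∀ {k} {u : Layers k} → h 0 ≡ 1 →
              (IsLayered (shift 2 h) → shift 2 h ≗ ⟦ u ⟧) → h ≗ ⟦ swap u ⟧
  swap-step h0≡1 ih zero = h0≡1
  swap-step h0≡1 ih (suc zero) = head-swap L h0≡1
  swap-step h0≡1 ih (suc (suc i)) =
    trans (shift-spec left-inverse inv-closed i) (cong (2 +_) (ih (shift-isLayered L h-closed inv-closed) i))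
    where
    h1≡0 : h 1 ≡ 0
    h1≡0 = head-swap L h0≡1
    h-closed : PrefixClosed 2 h
    h-closed {zero} _ = subst (_< 2) (sym h0≡1) (n<1+n 1)
    h-closed {suc zero} _ = subst (_< 2) (sym h1≡0) z<s
    h-closed {suc (suc _)} (s<s (s<s ()))
    inv-closed : PrefixClosed 2 inv
    inv-closed {zero} _ = subst (_< 2) (sym (trans (cong inv (sym h1≡0)) (left-inverse 1))) (n<1+n 1)
    inv-closed {suc zero} _ = subst (_< 2) (sym (trans (cong inv (sym h0≡1)) (left-inverse 0))) z<s
    inv-closed {suc (suc _)} (s<s (s<s ()))

layer : ∀ {A : Set} {k} → Dec A → Layers k → Layers (suc k) → Layers (suc (suc k))
layer (yes _) u _ = swap u
layer (no _) _ v = fix v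

layer-correct : ∀ {h k} {u : Layers k} {v : Layers (suc k)} → IsLayered h → (d : Dec (h 0 ≡ 1)) →
                (IsLayered (shift 2 h) → shift 2 h ≗ ⟦ u ⟧) →
                (IsLayered (shift 1 h) → shift 1 h ≗ ⟦ v ⟧) → h ≗ ⟦ layer d u v ⟧
layer-correct L (yes h0≡1) swap-ih _ = swap-step L h0≡1 swap-ih
layer-correct L (no h0≢1) _ fix-ih = fix-step L (head-fix L h0≢1) fix-ih

layersOf : (ℕ → ℕ) → (k : ℕ) → Layers k
layersOf h zero = none
layersOf h (suc zero) = fix none
layersOf h (suc (suc k)) = layer (h 0 ≟ 1) (layersOf (shift 2 h) k) (layersOf (shift 1 h) (suc k))

layersOf-correct : ∀ k {h} → IsLayered h → FixedFrom k h → h ≗ ⟦ layersOf h k ⟧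
layersOf-correct zero L fixed i = fixed z≤n
layersOf-correct (suc zero) {h} L fixed =
  fix-step L (head-fix L h0≢1) (λ L′ → layersOf-correct zero L′ (shift-fixedFrom 1 fixed))
  where
  h0≢1 : h 0 ≢ 1
  h0≢1 h0≡1 = 0≢1+n (trans (sym (head-swap L h0≡1)) (fixed {1} ≤-refl))
layersOf-correct (suc (suc k)) {h} L fixed =
  layer-correct L (h 0 ≟ 1) (λ L′ → layersOf-correct k L′ (shift-fixedFrom 2 fixed))
                            (λ L′ → layersOf-correct (suc k) L′ (shift-fixedFrom 1 fixed))

layersOf-unique : ∀ {k h} {u : Layers k} → IsLayered h → FixedFrom k h → h ≗ ⟦ u ⟧ → layersOf h k ≡ u
layersOf-unique {k} L fixed h≗u =
  ⟦⟧-injective _ _ λ i → trans (sym (layersOf-correct k L fixed i)) (h≗u i)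

-- Coloured tilings

-- The colour of a domino: which of σ and σ′ have a block 21 there.
data Kind : Set where
  first second both : Kind

data Tiling : ℕ → Set where
  none : Tiling 0
  fix  : ∀ {k} → Tiling k → Tiling (suc k)
  swap : ∀ {k} → Kind → Tiling k → Tiling (suc (suc k))

fstLayers sndLayers quotLayers : ∀ {k} → Tiling k → Layers k
fstLayers none = none
fstLayers (fix t) = fix (fstLayers t)
fstLayers (swap first t) = swap (fstLayers t)
fstLayers (swap second t) = fix (fix (fstLayers t))
fstLayers (swap both t) = swap (fstLayers t)
sndLayers none = none
sndLayers (fix t) = fix (sndLayers t)
sndLayers (swap first t) = fix (fix (sndLayers t))
sndLayers (swap second t) = swap (sndLayers t)
sndLayers (swap both t) = swap (sndLayers t)
quotLayers none = none
quotLayers (fix t) = fix (quotLayers t)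
quotLayers (swap first t) = swap (quotLayers t)
quotLayers (swap second t) = swap (quotLayers t)
quotLayers (swap both t) = fix (fix (quotLayers t))

quotLayers-⟦⟧ : ∀ {k} (t : Tiling k) i → ⟦ quotLayers t ⟧ i ≡ ⟦ sndLayers t ⟧ (⟦ fstLayers t ⟧ i)
quotLayers-⟦⟧ none i = refl
quotLayers-⟦⟧ (fix t) zero = refl
quotLayers-⟦⟧ (fix t) (suc i) = cong suc (quotLayers-⟦⟧ t i)
quotLayers-⟦⟧ (swap first t) zero = refl
quotLayers-⟦⟧ (swap first t) (suc zero) = refl
quotLayers-⟦⟧ (swap first t) (suc (suc i)) = cong (2 +_) (quotLayers-⟦⟧ t i)
quotLayers-⟦⟧ (swap second t) zero = refl
quotLayers-⟦⟧ (swap second t) (suc zero) = refl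
quotLayers-⟦⟧ (swap second t) (suc (suc i)) = cong (2 +_) (quotLayers-⟦⟧ t i)
quotLayers-⟦⟧ (swap both t) zero = refl
quotLayers-⟦⟧ (swap both t) (suc zero) = refl
quotLayers-⟦⟧ (swap both t) (suc (suc i)) = cong (2 +_) (quotLayers-⟦⟧ t i)

merge : ∀ {k} → Layers k → Layers k → Tiling k
merge none none = none
merge (fix u) (fix v) = fix (merge u v)
merge (swap u) (fix (fix v)) = swap first (merge u v)
merge (fix (fix u)) (swap v) = swap second (merge u v)
merge (swap u) (swap v) = swap both (merge u v)
-- Incompatible pairs (see merge-correct): any value will do.
merge (swap u) (fix (swap v)) = swap first (merge u u)
merge (fix (swap u)) (swap v) = swap second (merge v v)

merge-layers : ∀ {k} (t : Tiling k) → merge (fstLayers t) (sndLayers t) ≡ t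
merge-layers none = refl
merge-layers (fix t) = cong fix (merge-layers t)
merge-layers (swap first t) = cong (swap first) (merge-layers t)
merge-layers (swap second t) = cong (swap second) (merge-layers t)
merge-layers (swap both t) = cong (swap both) (merge-layers t)

-- Overlapping blocks 21 make the quotient send 0 two places to the right, or bring
-- the value 0 two places to the left: a non-adjacent inversion in either case.
merge-correct : ∀ {k} (u v : Layers k) → Adjacent (⟦ v ⟧ ∘ ⟦ u ⟧) →
                fstLayers (merge u v) ≡ u × sndLayers (merge u v) ≡ v
merge-correct none none _ = refl , refl
merge-correct (fix u) (fix v) adj =
  map (cong fix) (cong fix) (merge-correct u v (adjacent-shift 1 (λ _ → refl) adj))
merge-correct (swap u) (fix (fix v)) adj =
  map (cong swap) (cong (λ w → fix (fix w))) (merge-correct u v (adjacent-shift 2 (λ _ → refl) adj))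
merge-correct (fix (fix u)) (swap v) adj =
  map (cong (λ w → fix (fix w))) (cong swap) (merge-correct u v (adjacent-shift 2 (λ _ → refl) adj))
merge-correct (swap u) (swap v) adj =
  map (cong swap) (cong swap) (merge-correct u v (adjacent-shift 2 (λ _ → refl) adj))
merge-correct (swap u) (fix (swap v)) adj =
  contradiction (adj {0} {2 + ⟦ u ⟧ 0} z<s hj<h0) λ ()
  where
  hj<h0 : suc (⟦ fix (swap v) ⟧ (2 + ⟦ u ⟧ (⟦ u ⟧ 0))) ≤ 2
  hj<h0 = ≤-reflexive (cong (λ x → suc (⟦ fix (swap v) ⟧ (2 + x))) (⟦⟧-involutive u 0))
merge-correct (fix (swap u)) (swap v) adj = contradiction (adj {0} {2} z<s z<s) λ ()

Kind↔Fin3 : Kind ↔ Fin 3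
Kind↔Fin3 = mk↔ₛ′ index kind index∘kind kind∘index
  where
  index : Kind → Fin 3
  index first = Fin.zero
  index second = Fin.suc Fin.zero
  index both = Fin.suc (Fin.suc Fin.zero)
  kind : Fin 3 → Kind
  kind Fin.zero = first
  kind (Fin.suc Fin.zero) = second
  kind (Fin.suc (Fin.suc Fin.zero)) = both
  index∘kind : ∀ j → index (kind j) ≡ j
  index∘kind Fin.zero = refl
  index∘kind (Fin.suc Fin.zero) = refl
  index∘kind (Fin.suc (Fin.suc Fin.zero)) = refl
  kind∘index : ∀ κ → kind (index κ) ≡ κ
  kind∘index first = refl
  kind∘index second = refl
  kind∘index both = refl

Tiling-unfold : ∀ {k} → Tiling (suc (suc k)) ↔ (Tiling (suc k) ⊎ (Kind × Tiling k))
Tiling-unfold {k} = mk↔ₛ′ split join split∘join join∘split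
  where
  split : Tiling (suc (suc k)) → Tiling (suc k) ⊎ (Kind × Tiling k)
  split (fix t) = inj₁ t
  split (swap κ t) = inj₂ (κ , t)
  join : Tiling (suc k) ⊎ (Kind × Tiling k) → Tiling (suc (suc k))
  join (inj₁ t) = fix t
  join (inj₂ (κ , t)) = swap κ t
  split∘join : ∀ x → split (join x) ≡ x
  split∘join (inj₁ t) = refl
  split∘join (inj₂ (κ , t)) = refl
  join∘split : ∀ t → join (split t) ≡ t
  join∘split (fix t) = refl
  join∘split (swap κ t) = refl

Tiling-recurrence : ∀ {k m n} → Tiling (suc k) ↔ Fin m → Tiling k ↔ Fin n →
                    Tiling (suc (suc k)) ↔ Fin (m + 3 * n)
Tiling-recurrence e₁ e₀ =
  ↔-trans Tiling-unfold (↔-trans (e₁ ⊎-↔ (Kind↔Fin3 ×-↔ e₀))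
                       (↔-trans (↔-refl ⊎-↔ ↔-sym *↔×) (↔-sym +↔⊎)))

Tiling0↔Fin1 : Tiling 0 ↔ Fin 1
Tiling0↔Fin1 =
  mk↔ₛ′ (λ _ → Fin.zero) (λ _ → none) (λ { Fin.zero → refl ; (Fin.suc ()) }) (λ { none → refl })

Tiling1↔Fin1 : Tiling 1 ↔ Fin 1
Tiling1↔Fin1 =
  mk↔ₛ′ (λ _ → Fin.zero) (λ _ → fix none) (λ { Fin.zero → refl ; (Fin.suc ()) }) (λ { (fix none) → refl })

Tiling↔Fin-a : ∀ k → Tiling (suc k) ↔ Fin (a (suc k))
Tiling↔Fin-a zero = Tiling1↔Fin1
Tiling↔Fin-a (suc zero) = Tiling-recurrence Tiling1↔Fin1 Tiling0↔Fin1
Tiling↔Fin-a (suc (suc k)) = Tiling-recurrence (Tiling↔Fin-a (suc k)) (Tiling↔Fin-a k)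

-- Pattern avoidance

extend : ∀ {n} → (Fin n → Fin n) → ℕ → ℕ
extend {n} τ i with i <? n
... | yes i<n = toℕ (τ (fromℕ< i<n))
... | no _ = i

extend-toℕ : ∀ {n} (τ : Fin n → Fin n) j → extend τ (toℕ j) ≡ toℕ (τ j)
extend-toℕ {n} τ j with toℕ j <? n
... | yes j<n = cong (toℕ ∘ τ) (fromℕ<-toℕ j j<n)
... | no j≮n = contradiction (toℕ<n j) j≮n

extend-fixedFrom : ∀ {n} (τ : Fin n → Fin n) → FixedFrom n (extend τ)
extend-fixedFrom {n} τ {i} n≤i with i <? n
... | yes i<n = contradiction n≤i (<⇒≱ i<n)
... | no _ = refl

data Position (n : ℕ) : ℕ → Set where
  inside  : (j : Fin n) → Position n (toℕ j)
  outside : ∀ {i} → n ≤ i → Position n i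

position : ∀ n i → Position n i
position n i with i <? n
... | yes i<n = subst (Position n) (toℕ-fromℕ< i<n) (inside (fromℕ< i<n))
... | no i≮n = outside (≮⇒≥ i≮n)

extend-unique : ∀ {n} {τ : Fin n → Fin n} {f : ℕ → ℕ} →
                (∀ j → toℕ (τ j) ≡ f (toℕ j)) → FixedFrom n f → extend τ ≗ f
extend-unique {n} {τ} τ≗f f-fixed i with position n i
... | inside j = trans (extend-toℕ τ j) (τ≗f j)
... | outside n≤i = trans (extend-fixedFrom τ n≤i) (sym (f-fixed n≤i))

extend-injective : ∀ {n} {τ τ′ : Fin n → Fin n} → extend τ ≗ extend τ′ → τ ≗ τ′
extend-injective {τ = τ} {τ′} eq j =
  toℕ-injective (trans (sym (extend-toℕ τ j)) (trans (eq (toℕ j)) (extend-toℕ τ′ j)))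

extend-∘ : ∀ {n} (τ τ′ : Fin n → Fin n) → extend (τ ∘ τ′) ≗ extend τ ∘ extend τ′
extend-∘ τ τ′ = extend-unique
  (λ j → sym (trans (cong (extend τ) (extend-toℕ τ′ j)) (extend-toℕ τ (τ′ j))))
  (λ n≤i → trans (cong (extend τ) (extend-fixedFrom τ′ n≤i)) (extend-fixedFrom τ n≤i))

extend-inverse : ∀ {n} {τ τ′ : Fin n → Fin n} → (∀ j → τ (τ′ j) ≡ j) → ∀ i → extend τ (extend τ′ i) ≡ i
extend-inverse {τ = τ} {τ′} τ∘τ′ i =
  trans (sym (extend-∘ τ τ′ i)) (extend-unique (λ j → cong toℕ (τ∘τ′ j)) (λ _ → refl) i)

adjacent-extend : ∀ {n} {τ : Fin n → Fin n} →
                  (∀ {x y} → toℕ x < toℕ y → toℕ (τ y) < toℕ (τ x) → toℕ y ≡ suc (toℕ x)) →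
                  Adjacent (extend τ)
adjacent-extend {n} {τ} adj {i} {j} i<j lt with position n i | position n j
... | outside n≤i | _ =
  contradiction (subst₂ _<_ (extend-fixedFrom τ n≤j) (extend-fixedFrom τ n≤i) lt) (<-asym i<j)
  where n≤j = ≤-trans n≤i (<⇒≤ i<j)
... | inside x | outside n≤j =
  contradiction n≤j (<⇒≱ (<-trans (subst₂ _<_ (extend-fixedFrom τ n≤j) (extend-toℕ τ x) lt) (toℕ<n (τ x))))
... | inside x | inside y = adj i<j (subst₂ _<_ (extend-toℕ τ y) (extend-toℕ τ x) lt)

stair : ℕ → ℕ → ℕ → ℕ → ℕ → ℕ
stair a b c d zero = a
stair a b c d (suc zero) = b
stair a b c d (suc (suc zero)) = c
stair a b c d (suc (suc (suc r))) = r + d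

step⇒increasing : ∀ {f : ℕ → ℕ} → (∀ r → f r < f (suc r)) → f Preserves _<_ ⟶ _<_
step⇒increasing step {r} {suc s} r<1+s with m<1+n⇒m<n∨m≡n r<1+s
... | inj₁ r<s = <-trans (step⇒increasing step r<s) (step s)
... | inj₂ refl = step s

stair-increasing : ∀ {a b c d} → a < b → b < c → c < d → stair a b c d Preserves _<_ ⟶ _<_
stair-increasing {d = d} a<b b<c c<d = step⇒increasing step
  where
  step : ∀ r → stair _ _ _ d r < stair _ _ _ d (suc r)
  step zero = a<b
  step (suc zero) = b<c
  step (suc (suc zero)) = c<d
  step (suc (suc (suc r))) = +-monoˡ-< d (n<1+n r)

increasing-reflects : ∀ {f : ℕ → ℕ} → f Preserves _<_ ⟶ _<_ → ∀ {r s} → f r < f s → r < s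
increasing-reflects f-inc {r} {s} lt with <-cmp r s
... | tri< r<s _ _ = r<s
... | tri≈ _ refl _ = contradiction lt (<-irrefl refl)
... | tri> _ _ s<r = contradiction lt (<-asym (f-inc s<r))

-- Positions and values are images of strictly increasing stairs; the values are shifted
-- by one so that the stair can start at 0 below the pattern entries 1, 2, 3.
occurrence : ∀ {n} (τ : Fin n → Fin n) (p : Vec ℕ 3) {x z y : Fin n} {lo mid hi : ℕ} →
             toℕ x < toℕ z → toℕ z < toℕ y → lo < mid → mid < hi →
             (∀ a → suc (toℕ (τ (lookup (x ∷ z ∷ y ∷ []) a))) ≡ stair 0 (suc lo) (suc mid) (suc hi) (lookup p a)) →
             Contains τ (3 , p)
occurrence τ p {x} {z} {y} x<z z<y lo<mid mid<hi values = c , increasing , order-iso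
  where
  c : Fin 3 → Fin _
  c = lookup (x ∷ z ∷ y ∷ [])
  positions : ∀ a → toℕ (c a) ≡ stair (toℕ x) (toℕ z) (toℕ y) (suc (toℕ y)) (toℕ a)
  positions Fin.zero = refl
  positions (Fin.suc Fin.zero) = refl
  positions (Fin.suc (Fin.suc Fin.zero)) = refl
  increasing : ∀ a b → a Fin.< b → c a Fin.< c b
  increasing a b a<b =
    subst₂ _<_ (sym (positions a)) (sym (positions b)) (stair-increasing x<z z<y (n<1+n _) a<b)
  values-increasing = stair-increasing z<s (s<s lo<mid) (s<s mid<hi)
  order-iso : ∀ a b → (toℕ (τ (c a)) < toℕ (τ (c b))) ⇔ (lookup p a < lookup p b)
  order-iso a b = mk⇔
    (λ lt → increasing-reflects values-increasing (subst₂ _<_ (values a) (values b) (s<s lt)))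
    (λ lt → s<s⁻¹ (subst₂ _<_ (sym (values a)) (sym (values b)) (values-increasing lt)))

-- Relative to the values at y and x, the value at z is smallest, middle or largest:
-- patterns 312, 321 and 231 respectively.
inversion-around : ∀ {n} (τ : Fin n → Fin n) → Injective _≡_ _≡_ τ → ∀ {x z y} →
                   toℕ x < toℕ z → toℕ z < toℕ y → toℕ (τ y) < toℕ (τ x) →
                   Contains τ p231 ⊎ Contains τ p312 ⊎ Contains τ p321
inversion-around τ τ-injective {x} {z} {y} x<z z<y τy<τx
  with <-cmp (toℕ (τ z)) (toℕ (τ y)) | <-cmp (toℕ (τ z)) (toℕ (τ x))
... | tri< τz<τy _ _ | _ = inj₂ (inj₁ (occurrence τ (3 ∷ 1 ∷ 2 ∷ []) x<z z<y τz<τy τy<τx λ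
  { Fin.zero → refl ; (Fin.suc Fin.zero) → refl ; (Fin.suc (Fin.suc Fin.zero)) → refl }))
... | tri≈ _ τz≡τy _ | _ = contradiction (cong toℕ (τ-injective (toℕ-injective τz≡τy))) (<⇒≢ z<y)
... | tri> _ _ τy<τz | tri< τz<τx _ _ = inj₂ (inj₂ (occurrence τ (3 ∷ 2 ∷ 1 ∷ []) x<z z<y τy<τz τz<τx λ
  { Fin.zero → refl ; (Fin.suc Fin.zero) → refl ; (Fin.suc (Fin.suc Fin.zero)) → refl }))
... | tri> _ _ _ | tri≈ _ τz≡τx _ =
  contradiction (cong toℕ (τ-injective (toℕ-injective τz≡τx))) (≢-sym (<⇒≢ x<z))
... | tri> _ _ τy<τz | tri> _ _ τx<τz = inj₁ (occurrence τ (2 ∷ 3 ∷ 1 ∷ []) x<z z<y τy<τx τx<τz λ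
  { Fin.zero → refl ; (Fin.suc Fin.zero) → refl ; (Fin.suc (Fin.suc Fin.zero)) → refl })

non-adjacent-inversion : ∀ {n} (τ : Fin n → Fin n) → Injective _≡_ _≡_ τ → ∀ {x y} →
                         suc (toℕ x) < toℕ y → toℕ (τ y) < toℕ (τ x) →
                         Contains τ p231 ⊎ Contains τ p312 ⊎ Contains τ p321
non-adjacent-inversion τ τ-injective {x} {y} x+1<y =
  inversion-around τ τ-injective {z = fromℕ< (<-trans x+1<y (toℕ<n y))}
    (subst (toℕ x <_) (sym (toℕ-fromℕ< _)) (n<1+n _))
    (subst (_< toℕ y) (sym (toℕ-fromℕ< _)) x+1<y)

avoids⇒adjacent : ∀ {n} (τ : Fin n → Fin n) → Injective _≡_ _≡_ τ →
                  .(Avoids τ p231) → .(Avoids τ p312) → .(Avoids τ p321) → Adjacent (extend τ)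
avoids⇒adjacent τ τ-injective a231 a312 a321 = adjacent-extend adjacent-positions
  where
  adjacent-positions : ∀ {x y} → toℕ x < toℕ y → toℕ (τ y) < toℕ (τ x) → toℕ y ≡ suc (toℕ x)
  adjacent-positions {x} {y} x<y τy<τx with toℕ y ≟ suc (toℕ x)
  ... | yes y≡x+1 = y≡x+1
  ... | no y≢x+1 = ⊥-elim-irr ([ a231 , [ a312 , a321 ] ]
        (non-adjacent-inversion τ τ-injective (≤∧≢⇒< x<y (≢-sym y≢x+1)) τy<τx))

-- 231, 312 and 321 all have an inversion between their first and last entries.
adjacent⇒avoids : ∀ {n} {τ : Fin n → Fin n} → Adjacent (extend τ) →
                  ∀ {x y z} → z < x → Avoids τ (3 , x ∷ y ∷ z ∷ [])
adjacent⇒avoids {τ = τ} adj z<x (c , increasing , order-iso) = <-irrefl (sym c₂≡c₀+1) c₀+1<c₂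
  where
  c₀+1<c₂ : suc (toℕ (c Fin.zero)) < toℕ (c (Fin.suc (Fin.suc Fin.zero)))
  c₀+1<c₂ = <-≤-trans (s<s (increasing _ _ z<s)) (increasing _ _ (s<s z<s))
  c₂≡c₀+1 : toℕ (c (Fin.suc (Fin.suc Fin.zero))) ≡ suc (toℕ (c Fin.zero))
  c₂≡c₀+1 = adj (increasing _ _ z<s) (subst₂ _<_ (sym (extend-toℕ τ _)) (sym (extend-toℕ τ _))
                 (Equivalence.from (order-iso _ _) z<x))

-- The bijection

app∘appInv : ∀ {n} (σ : Perm n) j → app σ (appInv σ j) ≡ j
app∘appInv (mkPerm t f t∘f _) j = recompute (lookup t (lookup f j) Finₚ.≟ j) (t∘f j)

appInv∘app : ∀ {n} (σ : Perm n) j → appInv σ (app σ j) ≡ j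
appInv∘app (mkPerm t f _ f∘t) j = recompute (lookup f (lookup t j) Finₚ.≟ j) (f∘t j)

app-injective : ∀ {n} (σ : Perm n) → Injective _≡_ _≡_ (app σ)
app-injective σ {x} {y} eq = trans (sym (appInv∘app σ x)) (trans (cong (appInv σ) eq) (appInv∘app σ y))

appInv-injective : ∀ {n} (σ : Perm n) → Injective _≡_ _≡_ (appInv σ)
appInv-injective σ {x} {y} eq = trans (sym (app∘appInv σ x)) (trans (cong (app σ) eq) (app∘appInv σ y))

lookup-ext : ∀ {A : Set} {n} {v w : Vec A n} → (∀ j → lookup v j ≡ lookup w j) → v ≡ w
lookup-ext {v = v} {w} eq = trans (sym (tabulate∘lookup v)) (trans (tabulate-cong eq) (tabulate∘lookup w))

perm-ext : ∀ {n} {σ τ : Perm n} → app σ ≗ app τ → appInv σ ≗ appInv τ → σ ≡ τ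
perm-ext {σ = mkPerm t f _ _} {mkPerm t′ f′ _ _} t≗t′ f≗f′
  with lookup-ext {v = t} {t′} t≗t′ | lookup-ext {v = f} {f′} f≗f′
... | refl | refl = refl

perm-isLayered : ∀ {n} (σ : Perm n) → Adjacent (extend (app σ)) → IsLayered (extend (app σ))
perm-isLayered σ adj = record
  { inv           = extend (appInv σ)
  ; left-inverse  = extend-inverse (appInv∘app σ)
  ; right-inverse = extend-inverse (app∘appInv σ)
  ; adjacent      = adj
  }

extend-appInv : ∀ {n} (σ : Perm n) {u : Layers n} → extend (app σ) ≗ ⟦ u ⟧ → extend (appInv σ) ≗ ⟦ u ⟧
extend-appInv σ {u} σ≗u i = begin
  extend (appInv σ) i                        ≡⟨ sym (⟦⟧-involutive u _) ⟩
  ⟦ u ⟧ (⟦ u ⟧ (extend (appInv σ) i))         ≡⟨ cong ⟦ u ⟧ (sym (σ≗u _)) ⟩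
  ⟦ u ⟧ (extend (app σ) (extend (appInv σ) i)) ≡⟨ cong ⟦ u ⟧ (extend-inverse (app∘appInv σ) i) ⟩
  ⟦ u ⟧ i                                    ∎

layersFin : ∀ {n} → Layers n → Fin n → Fin n
layersFin u j = fromℕ< (⟦⟧-bounded u (toℕ<n j))

perm : ∀ {n} → Layers n → Perm n
perm u = mkPerm (tabulate (layersFin u)) (tabulate (layersFin u)) involutive involutive
  where
  involutive : ∀ j → lookup (tabulate (layersFin u)) (lookup (tabulate (layersFin u)) j) ≡ j
  involutive j = toℕ-injective (begin
    toℕ (lookup (tabulate (layersFin u)) (lookup (tabulate (layersFin u)) j))
      ≡⟨ cong toℕ (trans (lookup∘tabulate (layersFin u) _) (cong (layersFin u) (lookup∘tabulate (layersFin u) j))) ⟩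
    toℕ (layersFin u (layersFin u j)) ≡⟨ toℕ-fromℕ< _ ⟩
    ⟦ u ⟧ (toℕ (layersFin u j))       ≡⟨ cong ⟦ u ⟧ (toℕ-fromℕ< _) ⟩
    ⟦ u ⟧ (⟦ u ⟧ (toℕ j))             ≡⟨ ⟦⟧-involutive u _ ⟩
    toℕ j                             ∎)

perm-app : ∀ {n} (u : Layers n) j → toℕ (app (perm u) j) ≡ ⟦ u ⟧ (toℕ j)
perm-app u j = trans (cong toℕ (lookup∘tabulate (layersFin u) j)) (toℕ-fromℕ< _)

extend-perm : ∀ {n} (u : Layers n) → extend (app (perm u)) ≗ ⟦ u ⟧
extend-perm u = extend-unique (perm-app u) (⟦⟧-fixedFrom u)

perm-adjacent : ∀ {n} (u : Layers n) → Adjacent (extend (app (perm u)))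
perm-adjacent u = adjacent-cong (sym ∘ extend-perm u) (⟦⟧-adjacent u)

perm-unique : ∀ {n} (σ : Perm n) {u : Layers n} → extend (app σ) ≗ ⟦ u ⟧ → σ ≡ perm u
perm-unique σ {u} σ≗u = perm-ext
  (extend-injective λ i → trans (σ≗u i) (sym (extend-perm u i)))
  (extend-injective λ i → trans (extend-appInv σ {u} σ≗u i) (sym (extend-perm u i)))

layersOf-perm : ∀ {n} (u : Layers n) → layersOf (extend (app (perm u))) n ≡ u
layersOf-perm u =
  layersOf-unique {u = u} (perm-isLayered (perm u) (perm-adjacent u)) (extend-fixedFrom _) (extend-perm u)

Avoided : List Pattern
Avoided = p231 ∷ p312 ∷ p321 ∷ []

S2-ext : ∀ {n ps} {s s′ : S2 n ps} → S2.σ s ≡ S2.σ s′ → S2.σ' s ≡ S2.σ' s′ → s ≡ s′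
S2-ext {s = mk3 _ _ _} {mk3 _ _ _} refl refl = refl

fromTiling : ∀ {n} → Tiling n → S2 n Avoided
fromTiling t = mk3 (perm (fstLayers t)) (perm (sndLayers t))
  (avoids (s<s z<s) ∷ avoids (s<s (s<s z<s)) ∷ avoids (s<s z<s) ∷ [])
  where
  quot-adjacent : Adjacent (extend (comp-inv (perm (fstLayers t)) (perm (sndLayers t))))
  quot-adjacent = adjacent-cong (sym ∘ quot≗) (⟦⟧-adjacent (quotLayers t))
    where
    quot≗ = extend-unique
      (λ j → trans (perm-app (sndLayers t) _) (trans (cong ⟦ sndLayers t ⟧ (perm-app (fstLayers t) j))
                                                       (sym (quotLayers-⟦⟧ t (toℕ j)))))
      (⟦⟧-fixedFrom (quotLayers t))
  avoids : ∀ {x y z} → z < x → Avoids3 (perm (fstLayers t)) (perm (sndLayers t)) (3 , x ∷ y ∷ z ∷ [])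
  avoids z<x = adjacent⇒avoids (perm-adjacent (fstLayers t)) z<x
             , adjacent⇒avoids (perm-adjacent (sndLayers t)) z<x
             , adjacent⇒avoids quot-adjacent z<x

toTiling : ∀ {n} → S2 n Avoided → Tiling n
toTiling {n} (mk3 σ σ′ _) = merge (layersOf (extend (app σ)) n) (layersOf (extend (app σ′)) n)

toTiling-fromTiling : ∀ {n} (t : Tiling n) → toTiling (fromTiling t) ≡ t
toTiling-fromTiling t =
  trans (cong₂ merge (layersOf-perm (fstLayers t)) (layersOf-perm (sndLayers t))) (merge-layers t)

fromTiling-toTiling : ∀ {n} (s : S2 n Avoided) → fromTiling (toTiling s) ≡ s
fromTiling-toTiling {n} (mk3 σ σ′ av) =
  S2-ext (trans (cong perm (proj₁ merged)) (sym (perm-unique σ {u} σ≗u)))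
         (trans (cong perm (proj₂ merged)) (sym (perm-unique σ′ {v} σ′≗v)))
  where
  adjacent : ∀ (τ : Fin n → Fin n) → Injective _≡_ _≡_ τ → (∀ {p} → Avoids3 σ σ′ p → Avoids τ p) →
             Adjacent (extend τ)
  adjacent τ τ-injective pick = avoids⇒adjacent τ τ-injective
    (pick {p231} (All.head av)) (pick {p312} (All.head (All.tail av)))
    (pick {p321} (All.head (All.tail (All.tail av))))
  u v : Layers n
  u = layersOf (extend (app σ)) n
  v = layersOf (extend (app σ′)) n
  σ≗u : extend (app σ) ≗ ⟦ u ⟧
  σ≗u = layersOf-correct n (perm-isLayered σ (adjacent (app σ) (app-injective σ) proj₁)) (extend-fixedFrom _)
  σ′≗v : extend (app σ′) ≗ ⟦ v ⟧
  σ′≗v = layersOf-correct n (perm-isLayered σ′ (adjacent (app σ′) (app-injective σ′) (proj₁ ∘ proj₂)))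
                        (extend-fixedFrom _)
  quot≗ : extend (comp-inv σ σ′) ≗ ⟦ v ⟧ ∘ ⟦ u ⟧
  quot≗ i = trans (extend-∘ (app σ′) (appInv σ) i) (trans (σ′≗v _) (cong ⟦ v ⟧ (extend-appInv σ {u} σ≗u i)))
  merged : fstLayers (merge u v) ≡ u × sndLayers (merge u v) ≡ v
  merged = merge-correct u v (adjacent-cong quot≗
    (adjacent (comp-inv σ σ′) (appInv-injective σ ∘ app-injective σ′) (proj₂ ∘ proj₂)))

S2↔Tiling : ∀ n → S2 n Avoided ↔ Tiling n
S2↔Tiling n = mk↔ₛ′ toTiling fromTiling toTiling-fromTiling fromTiling-toTiling

theorem4p5 : (n : ℕ) → 1 ≤ n →
    S2 n (p231 ∷ p312 ∷ p321 ∷ []) ↔ Fin (a n)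
theorem4p5 (suc k) _ = ↔-trans (S2↔Tiling (suc k)) (Tiling↔Fin-a k)
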